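{- Let $C > 0$. If there exists an assignment $\mathbf{S}$ with $L(\mathbf{S}) \leq C$, then the linear program (GS) is feasible. In addition, in this case, if $(\lambda, \mu)$ is an optimal solution to (GS-D), then $\lambda_j > 0$ for all $j \in J$.
   Context: Finite sets $J$ (jobs) and $M$ (machines); for each $j \in J$ a processing speed function $g_j : 2^M \to \mathbb{R}_{\geq 0}$ that is $M^\natural$-concave (for $p \in \mathbb{R}^M$, $\mathcal{D}(g,p) := \operatorname{argmax}_{S\subseteq M}(g(S) - \sum_{i\in S}p_i)$, and $g$ is $M^\natural$-concave if for all $p' \leq p''$ and $S' \in \mathcal{D}(g,p')$ there is $S'' \in \mathcal{D}(g,p'')$ with $S' \cap \{i : p'_i = p''_i\} \subseteq S''$). An assignment $\mathbf{S} = (S_j)_{j\in J}$ consists of non-empty sets $S_j \subseteq M$, with load $L(\mathbf{S}) := \max_{i \in M} \sum_{j : i \in S_j} 1/g_j(S_j)$. The LP (GS) has variables $x(S,j) \geq 0$ for $j \in J$ and non-empty $S \subseteq M$, and $s_i \geq 0$ for $i \in M$: maximize $\sum_{i \in M} s_i$ subject to $\sum_{\emptyset \neq S \subseteq M} \big(2 - \frac{1}{C g_j(S)}\big) x(S,j) \geq 1$ for all $j \in J$ and $\sum_{j \in J} \sum_{S \subseteq M: i \in S} \frac{1}{g_j(S)} x(S,j) + s_i \leq C$ for all $i \in M$. Its dual (GS-D) has variables $\lambda_j$ ($j\in J$), $\mu_i$ ($i \in M$): minimize $-\sum_{j} \lambda_j + C \sum_i \mu_i$ subject to $\big(2 g_j(S)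 - \frac{1}{C}\big)\lambda_j - \sum_{i \in S}\mu_i \leq 0$ for all $j \in J$ and non-empty $S \subseteq M$, $\mu_i \geq 1$ for all $i$, $\lambda_j \geq 0$ for all $j$. -}

module Defs where

open import Level using (0ℓ)
open import Data.Nat using (ℕ; zero; suc)
open import Data.Bool using (Bool; true; false; if_then_else_; _∧_; _∨_)
open import Data.Fin using (Fin)
open import Data.Vec using ([]; _∷_; lookup)
open import Data.Fin.Subset using (Subset; inside; outside; _∈_; Nonempty)
open import Data.Product using (Σ; _×_; _,_)
open import Relation.Nullary using (¬_)
open import Relation.Binary.Structures using (IsTotalOrder)
open import Algebra.Structures using (IsCommutativeRing)

-- An ordered field (the LP is stated over an arbitrary ordered field;
-- the paper's setting is the instance ℝ).  The inverse is total; its value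
-- at 0 is unspecified and never matters below.
record OrderedField : Set₁ where
  infixl 7 _*_
  infixl 6 _+_ _-_
  infix 4 _≈_ _≤_ _<_
  field
    Carrier : Set
    _≈_ : Carrier → Carrier → Set
    _≤_ : Carrier → Carrier → Set
    _+_ _*_ : Carrier → Carrier → Carrier
    -_ : Carrier → Carrier
    _⁻¹ : Carrier → Carrier
    0# 1# : Carrier
    isCommutativeRing : IsCommutativeRing _≈_ _+_ _*_ -_ 0# 1#
    isTotalOrder : IsTotalOrder _≈_ _≤_
    0≉1 : ¬ (0# ≈ 1#)
    ⁻¹-inverse : ∀ x → ¬ (x ≈ 0#) → x * (x ⁻¹) ≈ 1#
    +-mono-≤ : ∀ x y z → x ≤ y → x + z ≤ y + z
    *-nonneg : ∀ x y → 0# ≤ x → 0# ≤ y → 0# ≤ x * y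

  _-_ : Carrier → Carrier → Carrier
  x - y = x + (- y)

  _<_ : Carrier → Carrier → Set
  x < y = (x ≤ y) × ¬ (x ≈ y)

  2# : Carrier
  2# = 1# + 1#

sumFin : {A : Set} → (A → A → A) → A → (n : ℕ) → (Fin n → A) → A
sumFin _⊕_ e zero f = e
sumFin _⊕_ e (suc n) f = f Fin.zero ⊕ sumFin _⊕_ e n (λ i → f (Fin.suc i))
  where import Data.Fin as Fin

sumSub : {A : Set} → (A → A → A) → A → (m : ℕ) → (Subset m → A) → A
sumSub _⊕_ e zero f = f []
sumSub _⊕_ e (suc m) f =
  sumSub _⊕_ e m (λ s → f (outside ∷ s)) ⊕ sumSub _⊕_ e m (λ s → f (inside ∷ s))

nonemptyB : {m : ℕ} → Subset m → Bool
nonemptyB [] = false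
nonemptyB (b ∷ s) = b ∨ nonemptyB s

module LP (F : OrderedField) where
  open OrderedField F public

  Σ[_]_ : (m : ℕ) → (Fin m → Carrier) → Carrier
  Σ[ m ] f = sumFin _+_ 0# m f

  sumIn : {m : ℕ} → Subset m → (Fin m → Carrier) → Carrier
  sumIn {m} S p = Σ[ m ] (λ i → if lookup S i then p i else 0#)

  ΣNE : (m : ℕ) → (Subset m → Carrier) → Carrier
  ΣNE m f = sumSub _+_ 0# m (λ S → if nonemptyB S then f S else 0#)

  InDemand : {m : ℕ} → (Subset m → Carrier) → (Fin m → Carrier) → Subset m → Set
  InDemand g p S = ∀ T → g T - sumIn T p ≤ g S - sumIn S p

  -- M♮-concavity (gross substitutes definition from the paper)
  MNatConcave : {m : ℕ} → (Subset m → Carrier) → Set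
  MNatConcave {m} g =
    ∀ (p' p'' : Fin m → Carrier) → (∀ i → p' i ≤ p'' i) →
    ∀ S' → InDemand g p' S' →
    Σ (Subset m) λ S'' → InDemand g p'' S'' ×
      (∀ i → i ∈ S' → p' i ≈ p'' i → i ∈ S'')

  IsAssignment : {n m : ℕ} → (Fin n → Subset m) → Set
  IsAssignment S = ∀ j → Nonempty (S j)

  -- L(S) ≤ C, where 1/0 = +∞ (so every g_j(S_j) must be positive) and
  -- max_i (...) ≤ C is unfolded to ∀ i, (...) ≤ C.
  LoadAtMost : {n m : ℕ} → (Fin n → Subset m → Carrier) → (Fin n → Subset m) → Carrier → Set
  LoadAtMost {n} {m} g S C =
    (∀ j → 0# < g j (S j)) ×
    (∀ (i : Fin m) → Σ[ n ] (λ j → if lookup (S j) i then (g j (S j)) ⁻¹ else 0#) ≤ C)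

  -- feasible solution (x, s) of (GS).  Variables x(S,j) with g_j(S) = 0 have
  -- coefficient 1/g_j(S) = +∞ and are therefore forced to be 0.
  GSFeasible : {n m : ℕ} → (Fin n → Subset m → Carrier) → Carrier →
               (Subset m → Fin n → Carrier) → (Fin m → Carrier) → Set
  GSFeasible {n} {m} g C x s =
    (∀ S j → 0# ≤ x S j) × (∀ i → 0# ≤ s i) ×
    (∀ S j → g j S ≈ 0# → x S j ≈ 0#) ×
    (∀ j → 1# ≤ ΣNE m (λ S → (2# - (C * g j S) ⁻¹) * x S j)) ×
    (∀ i → Σ[ n ] (λ j → ΣNE m (λ S → if lookup S i then (g j S) ⁻¹ * x S j else 0#)) + s i ≤ C)

  GSIsFeasible : {n m : ℕ} → (Fin n → Subset m → Carrier) → Carrier → Set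
  GSIsFeasible {n} {m} g C =
    Σ (Subset m → Fin n → Carrier) λ x → Σ (Fin m → Carrier) λ s → GSFeasible g C x s

  GSDFeasible : {n m : ℕ} → (Fin n → Subset m → Carrier) → Carrier →
                (Fin n → Carrier) → (Fin m → Carrier) → Set
  GSDFeasible {n} {m} g C lam mu =
    (∀ j S → Nonempty S → (2# * g j S - C ⁻¹) * lam j - sumIn S mu ≤ 0#) ×
    (∀ i → 1# ≤ mu i) × (∀ j → 0# ≤ lam j)

  GSDObjective : {n m : ℕ} → Carrier → (Fin n → Carrier) → (Fin m → Carrier) → Carrier
  GSDObjective {n} {m} C lam mu = (- Σ[ n ] lam) + C * Σ[ m ] mu

  GSDOptimal : {n m : ℕ} → (Fin n → Subset m → Carrier) → Carrier →
               (Fin n → Carrier) → (Fin m → Carrier) → Set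
  GSDOptimal {n} {m} g C lam mu =
    GSDFeasible g C lam mu ×
    (∀ lam' mu' → GSDFeasible g C lam' mu' →
       GSDObjective C lam mu ≤ GSDObjective C lam' mu')

-- Feasibility: put x(S, j) = 1 exactly when S = S_j and let s_i be the slack
-- C - load_i.  Every job j uses some machine i, whose load is at least
-- 1/g_j(S_j), so 1/(C g_j(S_j)) ≤ 1 and the covering coefficient 2 - 1/(C g_j(S_j))
-- is at least 1.
--
-- Positivity: if λ_j = 0 at a dual optimum, raise it to a small ε > 0 chosen
-- with 2 g_j(S) ε ≤ 1 for every S.  For non-empty S the j-th constraint still
-- holds, because its left-hand side is at most 1 ≤ μ_i ≤ Σ_{i∈S} μ_i, while the
-- objective drops by ε, contradicting optimality.
module Submission where

open import Defs
open import Data.Nat using (ℕ; zero; suc)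
open import Data.Fin as Fin using (Fin)
open import Function using (_∘_)
open import Data.Fin.Properties using () renaming (_≟_ to _≟ᶠ_)
open import Data.Fin.Subset using (Subset; Nonempty; _∈_)
open import Data.Product using (Σ; _×_; _,_; proj₁; proj₂)
open import Data.Sum using (inj₁; inj₂)
open import Data.Bool using (true; false; if_then_else_; _∨_)
open import Data.Bool.Properties using (∨-zeroʳ; if-cong)
import Data.Bool as Bool
open import Data.Empty using (⊥-elim)
open import Data.Vec using ([]; _∷_; lookup; here; there)
open import Data.Vec.Properties using (≡-dec; ∷-injectiveʳ; []=⇒lookup)
open import Data.Vec.Functional using (updateAt)
open import Data.Vec.Functional.Properties using (updateAt-updates; updateAt-minimal)
open import Relation.Nullary using (¬_; yes; no; does)
open import Relation.Nullary.Decidable using (dec-true; dec-false)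
open import Relation.Binary.PropositionalEquality as ≡ using (_≡_; _≢_)
open import Relation.Binary.Bundles using (Poset)
open import Relation.Binary.Structures using (IsTotalOrder)
open import Algebra.Bundles using (CommutativeRing)
open import Algebra.Structures using (IsCommutativeRing)
import Algebra.Properties.Ring as RingProperties
import Algebra.Properties.AbelianGroup as AbelianGroupProperties
import Relation.Binary.Reasoning.PartialOrder as PosetReasoning
import Relation.Binary.Reasoning.Setoid as SetoidReasoning

module Properties (F : OrderedField) where
  open LP F hiding (+-mono-≤)
  open IsCommutativeRing isCommutativeRing
    using (+-assoc; +-comm; +-identityˡ; +-identityʳ; -‿inverseˡ; -‿inverseʳ; -‿cong;
           *-identityˡ; *-identityʳ; *-comm; zeroʳ; +-cong; *-cong; setoid)
    renaming (refl to ≈-refl; sym to ≈-sym; trans to ≈-trans; reflexive to ≡⇒≈)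
  open IsTotalOrder isTotalOrder
    using (total; antisym; isPartialOrder)
    renaming (refl to ≤-refl; trans to ≤-trans; reflexive to ≤-reflexive; ≤-resp-≈ to ≤-resp₂-≈)

  commutativeRing : CommutativeRing _ _
  commutativeRing = record { isCommutativeRing = isCommutativeRing }

  open RingProperties (CommutativeRing.ring commutativeRing)
    using (-‿distribˡ-*; -‿distribʳ-*; [y-z]x≈yx-zx; -‿involutive)
  open AbelianGroupProperties (CommutativeRing.+-abelianGroup commutativeRing)
    using (⁻¹-∙-comm)

  poset : Poset _ _ _
  poset = record { isPartialOrder = isPartialOrder }

  module ≤-Reasoning = PosetReasoning poset
  module ≈-Reasoning = SetoidReasoning setoid

  ≤-respˡ-≈ : ∀ {x y z} → x ≈ y → x ≤ z → y ≤ z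
  ≤-respˡ-≈ = proj₂ ≤-resp₂-≈

  ≤-respʳ-≈ : ∀ {x y z} → y ≈ z → x ≤ y → x ≤ z
  ≤-respʳ-≈ = proj₁ ≤-resp₂-≈

  +-monoˡ-≤ : ∀ z {x y} → x ≤ y → x + z ≤ y + z
  +-monoˡ-≤ z {x} {y} = OrderedField.+-mono-≤ F x y z

  +-monoʳ-≤ : ∀ z {x y} → x ≤ y → z + x ≤ z + y
  +-monoʳ-≤ z x≤y = ≤-respˡ-≈ (+-comm _ z) (≤-respʳ-≈ (+-comm _ z) (+-monoˡ-≤ z x≤y))

  +-mono-≤ : ∀ {x y u v} → x ≤ y → u ≤ v → x + u ≤ y + v
  +-mono-≤ x≤y u≤v = ≤-trans (+-monoˡ-≤ _ x≤y) (+-monoʳ-≤ _ u≤v)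

  x≤x+y : ∀ x {y} → 0# ≤ y → x ≤ x + y
  x≤x+y x 0≤y = ≤-respˡ-≈ (+-identityʳ x) (+-monoʳ-≤ x 0≤y)

  x≤y⇒0≤y-x : ∀ {x y} → x ≤ y → 0# ≤ y - x
  x≤y⇒0≤y-x {x} x≤y = ≤-respˡ-≈ (-‿inverseʳ x) (+-monoˡ-≤ (- x) x≤y)

  x≤y⇒x-y≤0 : ∀ {x y} → x ≤ y → x - y ≤ 0#
  x≤y⇒x-y≤0 {y = y} x≤y = ≤-respʳ-≈ (-‿inverseʳ y) (+-monoˡ-≤ (- y) x≤y)

  0≤-x⇒x≤0 : ∀ {x} → 0# ≤ - x → x ≤ 0#
  0≤-x⇒x≤0 {x} 0≤-x = ≤-respˡ-≈ (+-identityˡ x) (≤-respʳ-≈ (-‿inverseˡ x) (+-monoˡ-≤ x 0≤-x))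

  0≤x⇒-x≤0 : ∀ {x} → 0# ≤ x → - x ≤ 0#
  0≤x⇒-x≤0 {x} 0≤x = ≤-respˡ-≈ (+-identityˡ (- x)) (≤-respʳ-≈ (-‿inverseʳ x) (+-monoˡ-≤ (- x) 0≤x))

  x≤0⇒0≤-x : ∀ {x} → x ≤ 0# → 0# ≤ - x
  x≤0⇒0≤-x {x} x≤0 = ≤-respˡ-≈ (-‿inverseʳ x) (≤-respʳ-≈ (+-identityˡ (- x)) (+-monoˡ-≤ (- x) x≤0))

  x≤x-y⇒y≤0 : ∀ {x y} → x ≤ x - y → y ≤ 0#
  x≤x-y⇒y≤0 {x} {y} x≤x-y = 0≤-x⇒x≤0 (≤-respʳ-≈ cancel (x≤y⇒0≤y-x x≤x-y))
    where
    cancel : (x - y) - x ≈ - y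
    cancel = ≈-trans (+-assoc x (- y) (- x))
      (≈-trans (+-cong ≈-refl (+-comm (- y) (- x)))
      (≈-trans (≈-sym (+-assoc x (- x) (- y)))
      (≈-trans (+-cong (-‿inverseʳ x) ≈-refl) (+-identityˡ (- y)))))

  *-monoˡ-≤-nonneg : ∀ {x y z} → 0# ≤ z → x ≤ y → x * z ≤ y * z
  *-monoˡ-≤-nonneg {x} {y} {z} 0≤z x≤y = ≤-respˡ-≈ (+-identityˡ (x * z)) (≤-respʳ-≈ cancel
    (+-monoˡ-≤ (x * z) (≤-respʳ-≈ ([y-z]x≈yx-zx z y x) (*-nonneg (y - x) z (x≤y⇒0≤y-x x≤y) 0≤z))))
    where
    cancel : (y * z - x * z) + x * z ≈ y * z
    cancel = ≈-trans (+-assoc (y * z) _ _)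
      (≈-trans (+-cong ≈-refl (-‿inverseˡ (x * z))) (+-identityʳ (y * z)))

  [x-y]z≤xz : ∀ x {y z} → 0# ≤ y → 0# ≤ z → (x - y) * z ≤ x * z
  [x-y]z≤xz x {y} {z} 0≤y 0≤z = ≤-respˡ-≈ (≈-sym ([y-z]x≈yx-zx z x y))
    (≤-respʳ-≈ (+-identityʳ (x * z)) (+-monoʳ-≤ (x * z) (0≤x⇒-x≤0 (*-nonneg y z 0≤y 0≤z))))

  -- In an ordered field 1 is a square: 1 = (-1)(-1).
  0≤1 : 0# ≤ 1#
  0≤1 with total 0# 1#
  ... | inj₁ 0≤1 = 0≤1
  ... | inj₂ 1≤0 = ≤-respʳ-≈ (-1*-1≈1) (*-nonneg _ _ (x≤0⇒0≤-x 1≤0) (x≤0⇒0≤-x 1≤0))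
    where
    -1*-1≈1 : (- 1#) * (- 1#) ≈ 1#
    -1*-1≈1 = ≈-trans (≈-sym (-‿distribˡ-* 1# (- 1#)))
      (≈-trans (-‿cong (≈-sym (-‿distribʳ-* 1# 1#)))
      (≈-trans (-‿involutive (1# * 1#)) (*-identityˡ 1#)))

  0≤2 : 0# ≤ 2#
  0≤2 = ≤-respˡ-≈ (+-identityˡ 0#) (+-mono-≤ 0≤1 0≤1)

  x⁻¹*x≈1 : ∀ {x} → 0# < x → x ⁻¹ * x ≈ 1#
  x⁻¹*x≈1 {x} (_ , 0≉x) = ≈-trans (*-comm (x ⁻¹) x) (⁻¹-inverse x (λ x≈0 → 0≉x (≈-sym x≈0)))

  1≤x⇒0<x : ∀ {x} → 1# ≤ x → 0# < x
  1≤x⇒0<x 1≤x = ≤-trans 0≤1 1≤x , λ 0≈x → 0≉1 (antisym 0≤1 (≤-respʳ-≈ (≈-sym 0≈x) 1≤x))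

  0<x⇒0<x⁻¹ : ∀ {x} → 0# < x → 0# < x ⁻¹
  0<x⇒0<x⁻¹ {x} 0<x@(0≤x , _) = 0≤x⁻¹ , 0≉x⁻¹
    where
    0≉x⁻¹ : ¬ (0# ≈ x ⁻¹)
    0≉x⁻¹ 0≈x⁻¹ = 0≉1 (≈-sym (begin
      1#         ≈⟨ ≈-sym (x⁻¹*x≈1 0<x) ⟩
      x ⁻¹ * x   ≈⟨ *-cong (≈-sym 0≈x⁻¹) ≈-refl ⟩
      0# * x     ≈⟨ *-comm 0# x ⟩
      x * 0#     ≈⟨ zeroʳ x ⟩
      0#         ∎))
      where open ≈-Reasoning
    0≤x⁻¹ : 0# ≤ x ⁻¹
    0≤x⁻¹ with total 0# (x ⁻¹)
    ... | inj₁ 0≤x⁻¹ = 0≤x⁻¹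
    ... | inj₂ x⁻¹≤0 = ⊥-elim (0≉1 (antisym 0≤1 (0≤-x⇒x≤0 0≤-1)))
      where
      0≤-1 : 0# ≤ - 1#
      0≤-1 = ≤-respʳ-≈ (≈-trans (≈-sym (-‿distribˡ-* (x ⁻¹) x)) (-‿cong (x⁻¹*x≈1 0<x)))
               (*-nonneg _ _ (x≤0⇒0≤-x x⁻¹≤0) 0≤x)

  x≤y⇒x*y⁻¹≤1 : ∀ {x y} → 0# < y → x ≤ y → x * y ⁻¹ ≤ 1#
  x≤y⇒x*y⁻¹≤1 {y = y} 0<y x≤y = ≤-respʳ-≈ (≈-trans (*-comm y (y ⁻¹)) (x⁻¹*x≈1 0<y))
    (*-monoˡ-≤-nonneg (proj₁ (0<x⇒0<x⁻¹ 0<y)) x≤y)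

  x⁻¹≤y⇒1≤y*x : ∀ {x y} → 0# < x → x ⁻¹ ≤ y → 1# ≤ y * x
  x⁻¹≤y⇒1≤y*x 0<x x⁻¹≤y = ≤-respˡ-≈ (x⁻¹*x≈1 0<x) (*-monoˡ-≤-nonneg (proj₁ 0<x) x⁻¹≤y)

  1≤x⇒1≤2-x⁻¹ : ∀ {x} → 1# ≤ x → 1# ≤ 2# - x ⁻¹
  1≤x⇒1≤2-x⁻¹ {x} 1≤x = ≤-respʳ-≈ (≈-sym (+-assoc 1# 1# (- (x ⁻¹)))) (x≤x+y 1# (x≤y⇒0≤y-x x⁻¹≤1))
    where
    x⁻¹≤1 : x ⁻¹ ≤ 1#
    x⁻¹≤1 = ≤-respˡ-≈ (*-identityˡ (x ⁻¹)) (x≤y⇒x*y⁻¹≤1 (1≤x⇒0<x 1≤x) 1≤x)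

  -[x+y]+z≈[-x+z]-y : ∀ x y z → - (x + y) + z ≈ (- x + z) - y
  -[x+y]+z≈[-x+z]-y x y z = begin
    - (x + y) + z       ≈⟨ +-cong (≈-sym (⁻¹-∙-comm x y)) ≈-refl ⟩
    (- x + - y) + z     ≈⟨ +-assoc (- x) (- y) z ⟩
    - x + (- y + z)     ≈⟨ +-cong ≈-refl (+-comm (- y) z) ⟩
    - x + (z + - y)     ≈⟨ ≈-sym (+-assoc (- x) z (- y)) ⟩
    (- x + z) - y       ∎
    where open ≈-Reasoning

  if-≈0 : ∀ b {x} → x ≈ 0# → (if b then x else 0#) ≈ 0#
  if-≈0 true x≈0 = x≈0
  if-≈0 false _ = ≈-refl

  if-cong-≈ : ∀ b {x y} → x ≈ y → (if b then x else 0#) ≈ (if b then y else 0#)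
  if-cong-≈ true x≈y = x≈y
  if-cong-≈ false _ = ≈-refl

  if-nonneg : ∀ b {x} → 0# ≤ x → 0# ≤ (if b then x else 0#)
  if-nonneg true 0≤x = 0≤x
  if-nonneg false _ = ≤-refl

  Σ-cong : ∀ n {f h : Fin n → Carrier} → (∀ i → f i ≈ h i) → Σ[ n ] f ≈ Σ[ n ] h
  Σ-cong zero f≈h = ≈-refl
  Σ-cong (suc n) f≈h = +-cong (f≈h Fin.zero) (Σ-cong n (λ i → f≈h (Fin.suc i)))

  Σ-nonneg : ∀ n {f : Fin n → Carrier} → (∀ i → 0# ≤ f i) → 0# ≤ Σ[ n ] f
  Σ-nonneg zero _ = ≤-refl
  Σ-nonneg (suc n) 0≤f =
    ≤-respˡ-≈ (+-identityˡ 0#) (+-mono-≤ (0≤f Fin.zero) (Σ-nonneg n (λ i → 0≤f (Fin.suc i))))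

  Σ-term≤ : ∀ n {f : Fin n → Carrier} → (∀ i → 0# ≤ f i) → ∀ i → f i ≤ Σ[ n ] f
  Σ-term≤ (suc n) 0≤f Fin.zero = x≤x+y _ (Σ-nonneg n (λ i → 0≤f (Fin.suc i)))
  Σ-term≤ (suc n) 0≤f (Fin.suc i) =
    ≤-respˡ-≈ (+-identityˡ _) (+-mono-≤ (0≤f Fin.zero) (Σ-term≤ n (λ k → 0≤f (Fin.suc k)) i))

  Σ-updateAt-+ : ∀ n (f : Fin n → Carrier) i e → Σ[ n ] updateAt f i (_+ e) ≈ Σ[ n ] f + e
  Σ-updateAt-+ (suc n) f Fin.zero e = begin
    (f Fin.zero + e) + Σ[ n ] (λ k → f (Fin.suc k))  ≈⟨ +-assoc _ e _ ⟩
    f Fin.zero + (e + Σ[ n ] (λ k → f (Fin.suc k)))  ≈⟨ +-cong ≈-refl (+-comm e _) ⟩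
    f Fin.zero + (Σ[ n ] (λ k → f (Fin.suc k)) + e)  ≈⟨ ≈-sym (+-assoc _ _ e) ⟩
    Σ[ suc n ] f + e                                 ∎
    where open ≈-Reasoning
  Σ-updateAt-+ (suc n) f (Fin.suc i) e =
    ≈-trans (+-cong ≈-refl (Σ-updateAt-+ n (λ k → f (Fin.suc k)) i e)) (≈-sym (+-assoc _ _ e))

  sumIn-≥ : ∀ {m} (S : Subset m) {p : Fin m → Carrier} → (∀ i → 0# ≤ p i) →
            ∀ {i} → i ∈ S → p i ≤ sumIn S p
  sumIn-≥ {m} S 0≤p {i} i∈S = ≤-respˡ-≈ (≡⇒≈ (if-cong ([]=⇒lookup i∈S)))
    (Σ-term≤ m (λ k → if-nonneg (lookup S k) (0≤p k)) i)

  ΣSub : (m : ℕ) → (Subset m → Carrier) → Carrier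
  ΣSub = sumSub _+_ 0#

  ΣSub-zero : ∀ m {f} → (∀ S → f S ≈ 0#) → ΣSub m f ≈ 0#
  ΣSub-zero zero f≈0 = f≈0 []
  ΣSub-zero (suc m) f≈0 =
    ≈-trans (+-cong (ΣSub-zero m (λ _ → f≈0 _)) (ΣSub-zero m (λ _ → f≈0 _))) (+-identityˡ 0#)

  ΣSub-nonneg : ∀ m {f} → (∀ S → 0# ≤ f S) → 0# ≤ ΣSub m f
  ΣSub-nonneg zero 0≤f = 0≤f []
  ΣSub-nonneg (suc m) 0≤f =
    ≤-respˡ-≈ (+-identityˡ 0#) (+-mono-≤ (ΣSub-nonneg m (λ _ → 0≤f _)) (ΣSub-nonneg m (λ _ → 0≤f _)))

  ΣSub-term≤ : ∀ m {f} → (∀ S → 0# ≤ f S) → ∀ T → f T ≤ ΣSub m f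
  ΣSub-term≤ zero 0≤f [] = ≤-refl
  ΣSub-term≤ (suc m) 0≤f (false ∷ T) =
    ≤-trans (ΣSub-term≤ m (λ _ → 0≤f _) T) (x≤x+y _ (ΣSub-nonneg m (λ _ → 0≤f _)))
  ΣSub-term≤ (suc m) 0≤f (true ∷ T) =
    ≤-respˡ-≈ (+-identityˡ _) (+-mono-≤ (ΣSub-nonneg m (λ _ → 0≤f _)) (ΣSub-term≤ m (λ _ → 0≤f _) T))

  ΣSub-concentrated : ∀ m {f} T → (∀ S → S ≢ T → f S ≈ 0#) → ΣSub m f ≈ f T
  ΣSub-concentrated zero [] _ = ≈-refl
  ΣSub-concentrated (suc m) (false ∷ T) f≈0 =
    ≈-trans (+-cong (ΣSub-concentrated m T (λ S S≢T → f≈0 _ (S≢T ∘ ∷-injectiveʳ)))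
                    (ΣSub-zero m (λ _ → f≈0 _ (λ ()))))
            (+-identityʳ _)
  ΣSub-concentrated (suc m) (true ∷ T) f≈0 =
    ≈-trans (+-cong (ΣSub-zero m (λ _ → f≈0 _ (λ ())))
                    (ΣSub-concentrated m T (λ S S≢T → f≈0 _ (S≢T ∘ ∷-injectiveʳ))))
            (+-identityˡ _)

  nonemptyB-complete : ∀ {m} {S : Subset m} → Nonempty S → nonemptyB S ≡ true
  nonemptyB-complete (_ , here) = ≡.refl
  nonemptyB-complete {S = b ∷ _} (Fin.suc i , there i∈S) =
    ≡.trans (≡.cong (b ∨_) (nonemptyB-complete (i , i∈S))) (∨-zeroʳ b)

  ΣNE-concentrated : ∀ m {f} {T} → Nonempty T → (∀ S → S ≢ T → f S ≈ 0#) → ΣNE m f ≈ f T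
  ΣNE-concentrated m {T = T} T≠∅ f≈0 =
    ≈-trans (ΣSub-concentrated m T (λ S S≢T → if-≈0 (nonemptyB S) (f≈0 S S≢T)))
            (≡⇒≈ (if-cong (nonemptyB-complete T≠∅)))

  -- The primal solution given by an assignment

  load : ∀ {n m} → (Fin n → Subset m → Carrier) → (Fin n → Subset m) → Fin m → Carrier
  load {n} g S i = Σ[ n ] (λ j → if lookup (S j) i then g j (S j) ⁻¹ else 0#)

  δ : ∀ {m} → Subset m → Subset m → Carrier
  δ S T = if does (≡-dec Bool._≟_ S T) then 1# else 0#

  *δ-refl : ∀ {m} x (T : Subset m) → x * δ T T ≈ x
  *δ-refl x T = ≈-trans (*-cong ≈-refl (≡⇒≈ (if-cong (dec-true (≡-dec Bool._≟_ T T) ≡.refl))))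
                        (*-identityʳ x)

  *δ-≢ : ∀ {m} x {S T : Subset m} → S ≢ T → x * δ S T ≈ 0#
  *δ-≢ x {S} {T} S≢T = ≈-trans (*-cong ≈-refl (≡⇒≈ (if-cong (dec-false (≡-dec Bool._≟_ S T) S≢T))))
                               (zeroʳ x)

  0≤δ : ∀ {m} (S T : Subset m) → 0# ≤ δ S T
  0≤δ S T with does (≡-dec Bool._≟_ S T)
  ... | true = 0≤1
  ... | false = ≤-refl

  inverse-speed≤C : ∀ {n m} {g : Fin n → Subset m → Carrier} {S C} →
                    LoadAtMost g S C → ∀ j → Nonempty (S j) → g j (S j) ⁻¹ ≤ C
  inverse-speed≤C {n} {S = S} (0<g , load≤C) j (i , i∈Sj) = ≤-trans
    (≤-respˡ-≈ (≡⇒≈ (if-cong ([]=⇒lookup i∈Sj)))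
      (Σ-term≤ n (λ k → if-nonneg (lookup (S k) i) (proj₁ (0<x⇒0<x⁻¹ (0<g k)))) j))
    (load≤C i)

  assignment⇒GSIsFeasible : ∀ {n m} (g : Fin n → Subset m → Carrier) C →
    Σ (Fin n → Subset m) (λ S → IsAssignment S × LoadAtMost g S C) → GSIsFeasible g C
  assignment⇒GSIsFeasible {n} {m} g C (S , S≠∅ , load≤C@(0<g , loadᵢ≤C)) =
    x , s , (λ T j → 0≤δ T (S j)) , (λ i → x≤y⇒0≤y-x (loadᵢ≤C i)) , x-vanishes , covered , capacity
    where
    x : Subset m → Fin n → Carrier
    x T j = δ T (S j)

    s : Fin m → Carrier
    s i = C - load g S i

    x-vanishes : ∀ T j → g j T ≈ 0# → x T j ≈ 0#
    x-vanishes T j gT≈0 with ≡-dec Bool._≟_ T (S j)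
    ... | yes ≡.refl = ⊥-elim (proj₂ (0<g j) (≈-sym gT≈0))
    ... | no _ = ≈-refl

    covered : ∀ j → 1# ≤ ΣNE m (λ T → (2# - (C * g j T) ⁻¹) * x T j)
    covered j = ≤-respʳ-≈
      (≈-sym (ΣNE-concentrated m (S≠∅ j) (λ T T≢Sj → *δ-≢ _ T≢Sj)))
      (≤-respʳ-≈ (≈-sym (*δ-refl _ (S j)))
        (1≤x⇒1≤2-x⁻¹ (x⁻¹≤y⇒1≤y*x (0<g j) (inverse-speed≤C {g = g} load≤C j (S≠∅ j)))))

    job-load : ∀ i j → ΣNE m (λ T → if lookup T i then g j T ⁻¹ * x T j else 0#)
                       ≈ (if lookup (S j) i then g j (S j) ⁻¹ else 0#)
    job-load i j = ≈-trans
      (ΣNE-concentrated m (S≠∅ j) (λ T T≢Sj → if-≈0 (lookup T i) (*δ-≢ _ T≢Sj)))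
      (if-cong-≈ (lookup (S j) i) (*δ-refl _ (S j)))

    capacity : ∀ i → Σ[ n ] (λ j → ΣNE m (λ T → if lookup T i then g j T ⁻¹ * x T j else 0#)) + s i ≤ C
    capacity i = ≤-reflexive (begin
      Σ[ n ] (λ j → ΣNE m _) + s i       ≈⟨ +-cong (Σ-cong n (job-load i)) ≈-refl ⟩
      load g S i + (C - load g S i)      ≈⟨ +-cong ≈-refl (+-comm C _) ⟩
      load g S i + (- load g S i + C)    ≈⟨ ≈-sym (+-assoc _ _ C) ⟩
      (load g S i - load g S i) + C      ≈⟨ +-cong (-‿inverseʳ _) ≈-refl ⟩
      0# + C                             ≈⟨ +-identityˡ C ⟩
      C                                  ∎)
      where open ≈-Reasoning

  -- Raising one coordinate of a dual solution

  raise : ∀ {n} → (Fin n → Carrier) → Fin n → Carrier → Fin n → Carrier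
  raise lam j ε = updateAt lam j (_+ ε)

  GSDObjective-raise : ∀ {n m} C (lam : Fin n → Carrier) (mu : Fin m → Carrier) j ε →
    GSDObjective C (raise lam j ε) mu ≈ GSDObjective C lam mu - ε
  GSDObjective-raise {n} C lam mu j ε = ≈-trans
    (+-cong (-‿cong (Σ-updateAt-+ n lam j ε)) ≈-refl)
    (-[x+y]+z≈[-x+z]-y (Σ[ n ] lam) ε _)

  GSDFeasible-raise : ∀ {n m} (g : Fin n → Subset m → Carrier) {C} → 0# < C →
    ∀ {lam mu} → GSDFeasible g C lam mu → ∀ j {ε} → lam j ≈ 0# → 0# ≤ ε →
    (∀ S → 2# * g j S * ε ≤ 1#) → GSDFeasible g C (raise lam j ε) mu
  GSDFeasible-raise g {C} 0<C {lam} {mu} (fits , 1≤mu , 0≤lam) j {ε} lamⱼ≈0 0≤ε 2gε≤1 =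
    fits′ , 1≤mu , 0≤lam′
    where
    0≤mu : ∀ i → 0# ≤ mu i
    0≤mu i = ≤-trans 0≤1 (1≤mu i)

    lamⱼ+ε≈ε : lam j + ε ≈ ε
    lamⱼ+ε≈ε = ≈-trans (+-cong lamⱼ≈0 ≈-refl) (+-identityˡ ε)

    fitsⱼ : ∀ S → Nonempty S → (2# * g j S - C ⁻¹) * (lam j + ε) ≤ sumIn S mu
    fitsⱼ S (i , i∈S) = begin
      (2# * g j S - C ⁻¹) * (lam j + ε)  ≈⟨ *-cong ≈-refl lamⱼ+ε≈ε ⟩
      (2# * g j S - C ⁻¹) * ε            ≤⟨ [x-y]z≤xz _ (proj₁ (0<x⇒0<x⁻¹ 0<C)) 0≤ε ⟩
      2# * g j S * ε                     ≤⟨ 2gε≤1 S ⟩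
      1#                                 ≤⟨ 1≤mu i ⟩
      mu i                               ≤⟨ sumIn-≥ S 0≤mu i∈S ⟩
      sumIn S mu                         ∎
      where open ≤-Reasoning

    fits′ : ∀ k S → Nonempty S → (2# * g k S - C ⁻¹) * raise lam j ε k - sumIn S mu ≤ 0#
    fits′ k S S≠∅ with k ≟ᶠ j
    ... | yes ≡.refl rewrite updateAt-updates j {_+ ε} lam = x≤y⇒x-y≤0 (fitsⱼ S S≠∅)
    ... | no k≢j rewrite updateAt-minimal k j {_+ ε} lam k≢j = fits k S S≠∅

    0≤lam′ : ∀ k → 0# ≤ raise lam j ε k
    0≤lam′ k with k ≟ᶠ j
    ... | yes ≡.refl rewrite updateAt-updates j {_+ ε} lam = ≤-respʳ-≈ (≈-sym lamⱼ+ε≈ε) 0≤ε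
    ... | no k≢j rewrite updateAt-minimal k j {_+ ε} lam k≢j = 0≤lam k

  GSDOptimal⇒0<lam : ∀ {n m} (g : Fin n → Subset m → Carrier) → (∀ j S → 0# ≤ g j S) →
    ∀ {C} → 0# < C → ∀ lam mu → GSDOptimal g C lam mu → ∀ j → 0# < lam j
  GSDOptimal⇒0<lam {m = m} g 0≤g {C} 0<C lam mu (feasible@(_ , _ , 0≤lam) , optimal) j =
    0≤lam j , λ 0≈lamⱼ → proj₂ 0<ε (antisym (proj₁ 0<ε) (ε≤0 (≈-sym 0≈lamⱼ)))
    where
    K : Carrier
    K = 1# + ΣSub m (λ S → 2# * g j S)

    0≤2g : ∀ S → 0# ≤ 2# * g j S
    0≤2g S = *-nonneg 2# (g j S) 0≤2 (0≤g j S)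

    0<K : 0# < K
    0<K = 1≤x⇒0<x (x≤x+y 1# (ΣSub-nonneg m 0≤2g))

    ε : Carrier
    ε = K ⁻¹

    0<ε : 0# < ε
    0<ε = 0<x⇒0<x⁻¹ 0<K

    2gε≤1 : ∀ S → 2# * g j S * ε ≤ 1#
    2gε≤1 S = x≤y⇒x*y⁻¹≤1 0<K
      (≤-trans (ΣSub-term≤ m 0≤2g S) (≤-respˡ-≈ (+-identityˡ _) (+-monoˡ-≤ _ 0≤1)))

    ε≤0 : lam j ≈ 0# → ε ≤ 0#
    ε≤0 lamⱼ≈0 = x≤x-y⇒y≤0 (≤-respʳ-≈ (GSDObjective-raise C lam mu j ε)
      (optimal (raise lam j ε) mu (GSDFeasible-raise g 0<C feasible j lamⱼ≈0 (proj₁ 0<ε) 2gε≤1)))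

open Properties using (assignment⇒GSIsFeasible; GSDOptimal⇒0<lam)

lemma1 : (F : OrderedField) → let open LP F in
    (n m : ℕ) (g : Fin n → Subset m → Carrier) →
    (∀ j S → 0# ≤ g j S) → (∀ j → MNatConcave (g j)) →
    (C : Carrier) → 0# < C →
    Σ (Fin n → Subset m) (λ S → IsAssignment S × LoadAtMost g S C) →
    GSIsFeasible g C ×
    (∀ lam mu → GSDOptimal g C lam mu → ∀ j → 0# < lam j)
lemma1 F n m g 0≤g _ C 0<C assignment =
  assignment⇒GSIsFeasible F g C assignment , GSDOptimal⇒0<lam F g 0≤g 0<C
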